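{- Let $K_n$ be the complete graph on $n$ vertices, $k$ a positive integer, and $j$ an integer with $0\le j\le\lfloor n/2\rfloor$. Then $$\lambda_j^k(K_n)=\begin{cases}0 & \text{if } k\ge n-j,\\ \binom{n-j}{2}-\left\lfloor\frac{n-j}{2}\right\rfloor k & \text{if } k<n-j.\end{cases}$$
   Context: Let $\lambda(G)$ denote the chromatic index of a simple graph $G$. For a positive integer $k$, a nonnegative integer $j$ and a graph $G=(V,E)$, a set $E'\subseteq E$ is a $k$-chromatic index $j$-mixed edge removal set if there exists $V'\subseteq V$ with $|V'|=j$ such that $\lambda(G-V'-E')\le k$, where $G-V'-E'$ is obtained by deleting the vertices of $V'$ (with incident edges) and the remaining edges of $E'$. The parameter $\lambda_j^k(G)$ is the minimum of $|E'|$ over all such sets. -}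

module Defs where

open import Level using (0ℓ)
open import Data.Nat using (ℕ; _≤_; _<_; _∸_; _*_; _/_)
open import Data.Nat.Combinatorics using (_C_)
open import Data.Fin using (Fin; toℕ)
open import Data.Fin.Subset using (Subset; _∉_; ∣_∣)
open import Data.List using (List; length)
open import Data.List.Relation.Unary.All using (All)
open import Data.List.Relation.Unary.Unique.Propositional using (Unique)
open import Data.List.Membership.Propositional using (_∈_)
open import Data.Product using (Σ; _×_; _,_)
open import Data.Sum using (_⊎_)
open import Relation.Nullary using (¬_)
open import Relation.Binary.PropositionalEquality using (_≡_; _≢_; refl) renaming (sym to ≡-sym)

record SimpleGraph (n : ℕ) : Set₁ where
  field
    Adj   : Fin n → Fin n → Set
    sym   : ∀ {u v} → Adj u v → Adj v u
    irrfl : ∀ {u} → ¬ Adj u u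
open SimpleGraph public

K : (n : ℕ) → SimpleGraph n
K n = record { Adj = λ u v → u ≢ v
             ; sym = λ p q → p (≡-sym q)
             ; irrfl = λ p → p refl }

record EdgeColouring {n : ℕ} (G : SimpleGraph n) (k : ℕ) : Set where
  field
    colour : ∀ u v → Adj G u v → Fin k
    symm   : ∀ u v (p : Adj G u v) → colour u v p ≡ colour v u (sym G p)
    proper : ∀ u v w (p : Adj G u v) (q : Adj G u w) → v ≢ w →
             colour u v p ≢ colour u w q

ChromaticIndex≤ : {n : ℕ} → SimpleGraph n → ℕ → Set
ChromaticIndex≤ G k = EdgeColouring G k

EdgeSet : {n : ℕ} → SimpleGraph n → List (Fin n × Fin n) → Set
EdgeSet G E = Unique E × All (λ { (u , v) → (toℕ u < toℕ v) × Adj G u v }) E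

-- G - V' - E'.  Deleted vertices are kept as isolated vertices (this does not
-- change the chromatic index).
remove : {n : ℕ} → SimpleGraph n → Subset n → List (Fin n × Fin n) → SimpleGraph n
remove {n} G V' E' = record
  { Adj = A
  ; sym = λ { (a , u∉ , v∉ , ne) → sym G a , v∉ , u∉ , λ { (_⊎_.inj₁ x) → ne (_⊎_.inj₂ x) ; (_⊎_.inj₂ x) → ne (_⊎_.inj₁ x) } }
  ; irrfl = λ { (a , _) → irrfl G a } }
  where
    A : Fin n → Fin n → Set
    A u v = Adj G u v × u ∉ V' × v ∉ V' × ¬ (((u , v) ∈ E') ⊎ ((v , u) ∈ E'))

MixedRemovalSet : {n : ℕ} → SimpleGraph n → (k j : ℕ) → List (Fin n × Fin n) → Set
MixedRemovalSet {n} G k j E' =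
  EdgeSet G E' × Σ (Subset n) (λ V' → (∣ V' ∣ ≡ j) × ChromaticIndex≤ (remove G V' E') k)

IsLambda : {n : ℕ} → SimpleGraph n → (k j m : ℕ) → Set
IsLambda G k j m =
  Σ (List _) (λ E' → MixedRemovalSet G k j E' × length E' ≡ m)
  × (∀ E' → MixedRemovalSet G k j E' → m ≤ length E')

-- After deleting j vertices, the m = n − j survivors span a K_m, and every pair of them is
-- either in E′ or an edge of the k-edge-coloured remainder.  A colour class is a matching,
-- hence has at most ⌊m/2⌋ edges, so C(m,2) ≤ |E′| + k ⌊m/2⌋.  Conversely, the round-robin
-- colouring of K_m uses q colours (q = m − 1 or m) with C(m,2) = q ⌊m/2⌋; deleting the edges
-- of the q − k colours ≥ k removes at most (q − k) ⌊m/2⌋ = C(m,2) − k ⌊m/2⌋ edges and leaves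
-- a k-edge-coloured graph.
module Submission where

open import Defs
open import Data.Nat using (ℕ; _≤_; _<_; _∸_; _*_; _/_)
open import Data.Nat.Combinatorics using (_C_)
open import Data.Product using (_×_)

open import Level using (0ℓ)
open import Data.Empty using (⊥; ⊥-elim)
open import Data.Nat
  using (zero; suc; _+_; pred; _%_; ⌊_/2⌋; ⌈_/2⌉; NonZero; z≤n; s≤s; s≤s⁻¹; z<s; s<s; _≟_; _≤?_)
open import Data.Nat.Properties
  using ( +-suc; +-identityʳ; +-assoc; +-comm; +-cancelˡ-≡; *-comm; *-suc; *-distribˡ-+; *-distribʳ-+
        ; *-distribʳ-∸; ≤-trans; ≤-antisym; n≮0; ≤∧≢⇒<; ≰⇒>; +-mono-≤; +-monoʳ-≤; *-monoˡ-≤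
        ; m∸[m∸n]≡n; m+[n∸m]≡n; ∸-monoˡ-<; m≤n+o⇒m∸n≤o; m≤n⇒m∸n≡0
        ; ⌊n/2⌋-mono; n≡⌊n+n/2⌋; ⌊n/2⌋≤⌈n/2⌉; ⌊n/2⌋+⌈n/2⌉≡n; module ≤-Reasoning )
open import Data.Nat.DivMod using (m≡m%n+[m/n]*n; m<n⇒m%n≡m; [m+kn]%n≡m%n; m%n<n; m/n≡1+[m∸n]/n; m/n≤m)
open import Data.Nat.Combinatorics using (nCk+nC[k+1]≡[n+1]C[k+1]; nC1≡n)
open import Data.Nat.Tactic.RingSolver using (solve-∀)
open import Data.Product using (Σ; _,_; proj₁; proj₂)
import Data.Product.Properties as ×
open import Data.Sum using (inj₁; inj₂)
open import Data.List using (List; []; _∷_; _++_; length; map; filter; upTo; applyUpTo)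
open import Data.List.Properties using (length-++; length-map; length-upTo; length-applyUpTo)
open import Data.List.Relation.Unary.All as All using (All; []; _∷_)
import Data.List.Relation.Unary.All.Properties as All
open import Data.List.Relation.Unary.AllPairs as AllPairs using (AllPairs; []; _∷_)
import Data.List.Relation.Unary.AllPairs.Properties as AllPairs
open import Data.List.Relation.Unary.Any using (here; there)
open import Data.List.Relation.Unary.Unique.Propositional using (Unique)
import Data.List.Relation.Unary.Unique.Propositional.Properties as Unique
open import Data.List.Membership.Propositional using (_∈_)
open import Data.List.Membership.Propositional.Properties
  using (∈-∃++; ∈-++⁺ˡ; ∈-++⁺ʳ; ∈-++⁻; ∈-map⁺; ∈-map⁻; ∈-filter⁺; ∈-filter⁻; ∈-upTo⁺; ∈-applyUpTo⁺)
import Data.List.Membership.DecPropositional as DecMembership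
open import Data.List.Relation.Binary.Subset.Propositional using (_⊆_)
open import Data.Fin as Fin using (Fin; zero; suc; toℕ)
import Data.Fin.Properties as Fin
open import Data.Vec using ([]; _∷_; here; there)
open import Data.Fin.Subset using (Subset; inside; outside; ∣_∣; ∁) renaming (_∈_ to _∈ᵖ_; _∉_ to _∉ᵖ_)
open import Data.Fin.Subset.Properties
  using (∣∁p∣≡n∸∣p∣; x∈∁p⇒x∉p; x∉p⇒x∈∁p) renaming (_∈?_ to _∈ᵖ?_)
open import Relation.Binary.Core using (Rel)
open import Relation.Binary.Definitions using (Asymmetric; tri<; tri≈; tri>)
open import Relation.Nullary using (Dec; yes; no; ¬?)
open import Relation.Nullary.Decidable using (_×-dec_; _⊎-dec_)
open import Relation.Unary using (Decidable)
open import Relation.Unary.Properties using (∁?)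
open import Relation.Binary.PropositionalEquality as ≡
  using (_≡_; _≢_; refl; cong; cong₂; subst; trans; module ≡-Reasoning)

module _ {A : Set} where

  unique-⊆⇒length-≤ : {xs ys : List A} → Unique xs → xs ⊆ ys → length xs ≤ length ys
  unique-⊆⇒length-≤ {[]} _ _ = z≤n
  unique-⊆⇒length-≤ {x ∷ xs} (x∉xs ∷ !xs) xs⊆ys
    with as , bs , refl ← ∈-∃++ (xs⊆ys (here refl)) = begin
      suc (length xs)               ≤⟨ s≤s (unique-⊆⇒length-≤ !xs xs⊆as++bs) ⟩
      suc (length (as ++ bs))       ≡⟨ cong suc (length-++ as) ⟩
      suc (length as + length bs)   ≡⟨ +-suc (length as) (length bs) ⟨
      length as + length (x ∷ bs)   ≡⟨ length-++ as ⟨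
      length (as ++ x ∷ bs)         ∎
    where
    open ≤-Reasoning
    xs⊆as++bs : xs ⊆ as ++ bs
    xs⊆as++bs z∈xs with ∈-++⁻ as (xs⊆ys (there z∈xs))
    ... | inj₁ z∈as          = ∈-++⁺ˡ z∈as
    ... | inj₂ (here refl)   = ⊥-elim (All.lookup x∉xs z∈xs refl)
    ... | inj₂ (there z∈bs)  = ∈-++⁺ʳ as z∈bs

  length-filter+length-filter-∁ : {P : A → Set} (P? : Decidable P) (xs : List A) →
    length (filter P? xs) + length (filter (∁? P?) xs) ≡ length xs
  length-filter+length-filter-∁ P? [] = refl
  length-filter+length-filter-∁ P? (x ∷ xs) with P? x
  ... | yes _ = cong suc (length-filter+length-filter-∁ P? xs)
  ... | no _  = trans (+-suc _ _) (cong suc (length-filter+length-filter-∁ P? xs))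

suc-C2 : ∀ n → suc n C 2 ≡ n + n C 2
suc-C2 n = trans (≡.sym (nCk+nC[k+1]≡[n+1]C[k+1] n 1)) (cong (_+ n C 2) (nC1≡n n))

module _ {A : Set} where

  pairs : List A → List (A × A)
  pairs []       = []
  pairs (x ∷ xs) = map (x ,_) xs ++ pairs xs

  length-pairs : (xs : List A) → length (pairs xs) ≡ length xs C 2
  length-pairs []       = refl
  length-pairs (x ∷ xs) = begin
    length (map (x ,_) xs ++ pairs xs)          ≡⟨ length-++ (map (x ,_) xs) ⟩
    length (map (x ,_) xs) + length (pairs xs)  ≡⟨ cong₂ _+_ (length-map _ xs) (length-pairs xs) ⟩
    length xs + length xs C 2                   ≡⟨ suc-C2 (length xs) ⟨
    suc (length xs) C 2                         ∎
    where open ≡-Reasoning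

  module _ {_<_ : Rel A 0ℓ} where

    ∈-pairs⁻ : ∀ {xs} → AllPairs _<_ xs → ∀ {u v} → (u , v) ∈ pairs xs → u < v × u ∈ xs × v ∈ xs
    ∈-pairs⁻ {x ∷ xs} (x<xs ∷ <xs) uv∈ with ∈-++⁻ (map (x ,_) xs) uv∈
    ... | inj₁ uv∈x,xs with _ , v∈xs , refl ← ∈-map⁻ (x ,_) uv∈x,xs = All.lookup x<xs v∈xs , here refl , there v∈xs
    ... | inj₂ uv∈pairs = let u<v , u∈ , v∈ = ∈-pairs⁻ <xs uv∈pairs in u<v , there u∈ , there v∈

    ∈-pairs⁺ : Asymmetric _<_ → ∀ {xs} → AllPairs _<_ xs →
               ∀ {u v} → u ∈ xs → v ∈ xs → u < v → (u , v) ∈ pairs xs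
    ∈-pairs⁺ asym          (_ ∷ _)    (here refl) (here refl) u<u = ⊥-elim (asym u<u u<u)
    ∈-pairs⁺ asym {x ∷ xs} (_ ∷ _)    (here refl) (there v∈)  _   = ∈-++⁺ˡ (∈-map⁺ (x ,_) v∈)
    ∈-pairs⁺ asym          (x<xs ∷ _) (there u∈)  (here refl) v<u = ⊥-elim (asym v<u (All.lookup x<xs u∈))
    ∈-pairs⁺ asym {x ∷ xs} (_ ∷ <xs)  (there u∈)  (there v∈)  u<v =
      ∈-++⁺ʳ (map (x ,_) xs) (∈-pairs⁺ asym <xs u∈ v∈ u<v)

  unique-pairs : ∀ {xs} → Unique xs → Unique (pairs xs)
  unique-pairs {[]}     []          = []
  unique-pairs {x ∷ xs} (x∉xs ∷ !xs) =
    Unique.++⁺ (Unique.map⁺ (cong proj₂) !xs) (unique-pairs !xs) (λ (p , q) → x∉pairs p q)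
    where
    x∉pairs : ∀ {e} → e ∈ map (x ,_) xs → e ∈ pairs xs → ⊥
    x∉pairs e∈ e∈pairs with _ , _ , refl ← ∈-map⁻ (x ,_) e∈ =
      All.lookup x∉xs (proj₁ (proj₂ (∈-pairs⁻ !xs e∈pairs))) refl

module _ {V : Set} where

  Disjoint : Rel (V × V) 0ℓ
  Disjoint (u , v) (x , y) = u ≢ x × u ≢ y × v ≢ x × v ≢ y

  EdgeOn : List V → V × V → Set
  EdgeOn W (u , v) = u ≢ v × u ∈ W × v ∈ W

  endpoints : List (V × V) → List V
  endpoints []             = []
  endpoints ((u , v) ∷ M)  = u ∷ v ∷ endpoints M

  length-endpoints : (M : List (V × V)) → length (endpoints M) ≡ length M + length M
  length-endpoints []      = refl
  length-endpoints (_ ∷ M) = cong suc (trans (cong suc (length-endpoints M)) (≡.sym (+-suc _ _)))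

  ≢-endpoints : ∀ {u v M} → All (Disjoint (u , v)) M →
                All (u ≢_) (endpoints M) × All (v ≢_) (endpoints M)
  ≢-endpoints {M = []}    []                       = [] , []
  ≢-endpoints {M = _ ∷ _} ((u≢x , u≢y , v≢x , v≢y) ∷ ds) =
    let u∉ , v∉ = ≢-endpoints ds in (u≢x ∷ u≢y ∷ u∉) , (v≢x ∷ v≢y ∷ v∉)

  unique-endpoints : ∀ {W M} → AllPairs Disjoint M → All (EdgeOn W) M → Unique (endpoints M)
  unique-endpoints {M = []}    []       []                  = []
  unique-endpoints {M = _ ∷ _} (d ∷ ds) ((u≢v , _) ∷ es) =
    let u∉ , v∉ = ≢-endpoints d in (u≢v ∷ u∉) ∷ v∉ ∷ unique-endpoints ds es

  endpoints-⊆ : ∀ {W M} → All (EdgeOn W) M → endpoints M ⊆ W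
  endpoints-⊆ ((_ , u∈W , _) ∷ _)  (here refl)         = u∈W
  endpoints-⊆ ((_ , _ , v∈W) ∷ _)  (there (here refl)) = v∈W
  endpoints-⊆ (_ ∷ es)             (there (there z∈))  = endpoints-⊆ es z∈

  matching-length-≤ : ∀ W M → AllPairs Disjoint M → All (EdgeOn W) M → length M ≤ ⌊ length W /2⌋
  matching-length-≤ W M ds es = begin
    length M                              ≡⟨ n≡⌊n+n/2⌋ (length M) ⟩
    ⌊ length M + length M /2⌋             ≡⟨ cong ⌊_/2⌋ (length-endpoints M) ⟨
    ⌊ length (endpoints M) /2⌋            ≤⟨ ⌊n/2⌋-mono (unique-⊆⇒length-≤ (unique-endpoints ds es) (endpoints-⊆ es)) ⟩
    ⌊ length W /2⌋                        ∎
    where open ≤-Reasoning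

  module _ (col : V × V → ℕ) where

    SameColourDisjoint : Rel (V × V) 0ℓ
    SameColourDisjoint e e′ = col e ≡ col e′ → Disjoint e e′

    monochromatic⇒matching : ∀ {c M} → All (λ e → col e ≡ c) M → AllPairs SameColourDisjoint M →
                             AllPairs Disjoint M
    monochromatic⇒matching []         []       = []
    monochromatic⇒matching (ce ∷ ces) (d ∷ ds) =
      All.zipWith (λ (ce′ , d′) → d′ (trans ce (≡.sym ce′))) (ces , d) ∷ monochromatic⇒matching ces ds

    colourClasses-length-≤ : ∀ W cs L → AllPairs SameColourDisjoint L → All (EdgeOn W) L →
                             All (λ e → col e ∈ cs) L → length L ≤ length cs * ⌊ length W /2⌋
    colourClasses-length-≤ W []       []      _  _  _             = z≤n
    colourClasses-length-≤ W []       (_ ∷ _) _  _  (() ∷ _)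
    colourClasses-length-≤ W (c ∷ cs) L       ds es cols = begin
      length L                                       ≡⟨ length-filter+length-filter-∁ colour-c? L ⟨
      length (filter colour-c? L) + length rest      ≤⟨ +-mono-≤ class-length rest-length ⟩
      ⌊ length W /2⌋ + length cs * ⌊ length W /2⌋    ∎
      where
      open ≤-Reasoning
      colour-c? : ∀ e → Dec (col e ≡ c)
      colour-c? e = col e ≟ c
      rest : List (V × V)
      rest = filter (∁? colour-c?) L
      class-length : length (filter colour-c? L) ≤ ⌊ length W /2⌋
      class-length = matching-length-≤ W _
        (monochromatic⇒matching (All.all-filter colour-c? L) (AllPairs.filter⁺ colour-c? ds))
        (All.filter⁺ colour-c? es)
      col∈cs : ∀ {e} → col e ∈ c ∷ cs → col e ≢ c → col e ∈ cs
      col∈cs (here refl) col≢c = ⊥-elim (col≢c refl)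
      col∈cs (there ∈cs) _     = ∈cs
      rest-length : length rest ≤ length cs * ⌊ length W /2⌋
      rest-length = colourClasses-length-≤ W cs rest (AllPairs.filter⁺ (∁? colour-c?) ds)
        (All.filter⁺ (∁? colour-c?) es)
        (All.zipWith (λ (∈c∷cs , ≢c) → col∈cs ∈c∷cs ≢c)
          (All.filter⁺ (∁? colour-c?) cols , All.all-filter (∁? colour-c?) L))

members : ∀ {n} → Subset n → List (Fin n)
members []            = []
members (inside ∷ p)  = zero ∷ map suc (members p)
members (outside ∷ p) = map suc (members p)

length-members : ∀ {n} (p : Subset n) → length (members p) ≡ ∣ p ∣
length-members []            = refl
length-members (inside ∷ p)  = cong suc (trans (length-map suc (members p)) (length-members p))
length-members (outside ∷ p) = trans (length-map suc (members p)) (length-members p)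

∈-members⁺ : ∀ {n} {p : Subset n} {i} → i ∈ᵖ p → i ∈ members p
∈-members⁺ here       = here refl
∈-members⁺ {p = inside ∷ _}  (there i∈p) = there (∈-map⁺ suc (∈-members⁺ i∈p))
∈-members⁺ {p = outside ∷ _} (there i∈p) = ∈-map⁺ suc (∈-members⁺ i∈p)

∈-members⁻ : ∀ {n} {p : Subset n} {i} → i ∈ members p → i ∈ᵖ p
∈-members⁻ {p = inside ∷ _} (here refl) = here
∈-members⁻ {p = inside ∷ _} (there i∈)  with _ , j∈ , refl ← ∈-map⁻ suc i∈ = there (∈-members⁻ j∈)
∈-members⁻ {p = outside ∷ _} i∈         with _ , j∈ , refl ← ∈-map⁻ suc i∈ = there (∈-members⁻ j∈)

members-sorted : ∀ {n} (p : Subset n) → AllPairs Fin._<_ (members p)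
members-sorted []            = []
members-sorted (inside ∷ p)  =
  All.map⁺ (All.tabulate (λ _ → z<s)) ∷ AllPairs.map⁺ (AllPairs.map s<s (members-sorted p))
members-sorted (outside ∷ p) = AllPairs.map⁺ (AllPairs.map s<s (members-sorted p))

length-members-∁ : ∀ {n j} (V′ : Subset n) → ∣ V′ ∣ ≡ j → length (members (∁ V′)) ≡ n ∸ j
length-members-∁ V′ refl = trans (length-members (∁ V′)) (∣∁p∣≡n∸∣p∣ V′)

atLeast : ∀ {n} → ℕ → Subset n
atLeast {zero}  _       = []
atLeast {suc n} zero    = inside ∷ atLeast zero
atLeast {suc n} (suc m) = outside ∷ atLeast m

∣atLeast∣ : ∀ n m → ∣ atLeast {n} m ∣ ≡ n ∸ m
∣atLeast∣ zero    zero    = refl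
∣atLeast∣ zero    (suc m) = refl
∣atLeast∣ (suc n) zero    = cong suc (∣atLeast∣ n zero)
∣atLeast∣ (suc n) (suc m) = ∣atLeast∣ n m

∉atLeast⇒< : ∀ {n m} {i : Fin n} → i ∉ᵖ atLeast m → toℕ i < m
∉atLeast⇒< {suc n} {zero}  {zero}  i∉ = ⊥-elim (i∉ here)
∉atLeast⇒< {suc n} {zero}  {suc i} i∉ = ⊥-elim (n≮0 (∉atLeast⇒< (λ i∈ → i∉ (there i∈))))
∉atLeast⇒< {suc n} {suc m} {zero}  i∉ = z<s
∉atLeast⇒< {suc n} {suc m} {suc i} i∉ = s<s (∉atLeast⇒< (λ i∈ → i∉ (there i∈)))

module _ {n k} {G : SimpleGraph n} (adj? : ∀ u v → Dec (Adj G u v)) (c : EdgeColouring G k) where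
  open EdgeColouring c

  -- colour takes an adjacency proof; colourOf picks one (junk 0 on non-edges), and everything
  -- below only compares colourOf with colour at that same proof.
  colourOf : Fin n × Fin n → ℕ
  colourOf (u , v) with adj? u v
  ... | yes p = toℕ (colour u v p)
  ... | no _  = 0

  colourOf-edge : ∀ {u v} → Adj G u v → Σ (Adj G u v) λ p → colourOf (u , v) ≡ toℕ (colour u v p)
  colourOf-edge {u} {v} a with adj? u v
  ... | yes p = p , refl
  ... | no ¬a = ⊥-elim (¬a a)

  colourOf<k : ∀ {u v} → Adj G u v → colourOf (u , v) < k
  colourOf<k a = let p , eq = colourOf-edge a in subst (_< k) (≡.sym eq) (Fin.toℕ<n _)

  sameColour⇒disjoint : ∀ {u v x y} → u Fin.< v → x Fin.< y → Adj G u v → Adj G x y →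
                        (u , v) ≢ (x , y) → colourOf (u , v) ≡ colourOf (x , y) → Disjoint (u , v) (x , y)
  sameColour⇒disjoint {u} {v} {x} {y} u<v x<y a b uv≢xy same =
    u≢x colour≡ , u≢y colour≡ , v≢x colour≡ , v≢y colour≡
    where
    p : Adj G u v
    p = proj₁ (colourOf-edge a)
    q : Adj G x y
    q = proj₁ (colourOf-edge b)
    colour≡ : colour u v p ≡ colour x y q
    colour≡ = Fin.toℕ-injective (trans (≡.sym (proj₂ (colourOf-edge a))) (trans same (proj₂ (colourOf-edge b))))
    u≢x : colour u v p ≡ colour x y q → u ≢ x
    u≢x eq refl = proper u v y p q (λ { refl → uv≢xy refl }) eq
    u≢y : colour u v p ≡ colour x y q → u ≢ y
    u≢y eq refl = proper u v x p (sym G q) (λ { refl → Fin.<-asym u<v x<y }) (trans eq (symm x u q))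
    v≢x : colour u v p ≡ colour x y q → v ≢ x
    v≢x eq refl = proper v u y (sym G p) q (λ { refl → Fin.<-asym u<v x<y }) (trans (≡.sym (symm u v p)) eq)
    v≢y : colour u v p ≡ colour x y q → v ≢ y
    v≢y eq refl = proper v u x (sym G p) (sym G q) (λ { refl → uv≢xy refl })
                    (trans (≡.sym (symm u v p)) (trans eq (symm x v q)))

  edgeSet⇒sameColourDisjoint : ∀ {L} → EdgeSet G L → AllPairs (SameColourDisjoint colourOf) L
  edgeSet⇒sameColourDisjoint {[]}          ([] , [])                 = []
  edgeSet⇒sameColourDisjoint {(u , v) ∷ L} (e∉L ∷ !L , (u<v , a) ∷ es) =
    All.zipWith (λ { {x , y} (uv≢xy , x<y , b) → sameColour⇒disjoint u<v x<y a b uv≢xy }) (e∉L , es)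
    ∷ edgeSet⇒sameColourDisjoint (!L , es)

_∈ᴱ?_ : ∀ {n} (e : Fin n × Fin n) (E : List (Fin n × Fin n)) → Dec (e ∈ E)
e ∈ᴱ? E = DecMembership._∈?_ (×.≡-dec Fin._≟_ Fin._≟_) e E

K-adj? : ∀ {n} (u v : Fin n) → Dec (Adj (K n) u v)
K-adj? u v = ¬? (u Fin.≟ v)

remove-adj? : ∀ {n} {G : SimpleGraph n} → (∀ u v → Dec (Adj G u v)) →
              ∀ V′ E′ (u v : Fin n) → Dec (Adj (remove G V′ E′) u v)
remove-adj? adj? V′ E′ u v =
  adj? u v ×-dec ¬? (u ∈ᵖ? V′) ×-dec ¬? (v ∈ᵖ? V′) ×-dec ¬? ((u , v) ∈ᴱ? E′ ⊎-dec (v , u) ∈ᴱ? E′)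

mixedRemovalSet-lowerBound : ∀ {n k j E′} → MixedRemovalSet (K n) k j E′ →
                             (n ∸ j) C 2 ≤ ⌊ n ∸ j /2⌋ * k + length E′
mixedRemovalSet-lowerBound {n} {k} {j} {E′} ((_ , E′-edges) , V′ , ∣V′∣≡j , c) = begin
  (n ∸ j) C 2                                      ≡⟨ cong (_C 2) |W|≡n∸j ⟨
  length W C 2                                     ≡⟨ length-pairs W ⟨
  length P                                         ≡⟨ length-filter+length-filter-∁ (_∈ᴱ? E′) P ⟨
  length removed + length kept                     ≤⟨ +-mono-≤ removed-length kept-length ⟩
  length E′ + k * ⌊ n ∸ j /2⌋                      ≡⟨ +-comm (length E′) _ ⟩
  k * ⌊ n ∸ j /2⌋ + length E′                      ≡⟨ cong (_+ length E′) (*-comm k _) ⟩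
  ⌊ n ∸ j /2⌋ * k + length E′                      ∎
  where
  open ≤-Reasoning
  W : List (Fin n)
  W = members (∁ V′)
  |W|≡n∸j : length W ≡ n ∸ j
  |W|≡n∸j = length-members-∁ V′ ∣V′∣≡j
  P removed kept : List (Fin n × Fin n)
  P = pairs W
  removed = filter (_∈ᴱ? E′) P
  kept = filter (∁? (_∈ᴱ? E′)) P
  !P : Unique P
  !P = unique-pairs (AllPairs.map Fin.<⇒≢ (members-sorted (∁ V′)))
  removed-length : length removed ≤ length E′
  removed-length = unique-⊆⇒length-≤ (Unique.filter⁺ (_∈ᴱ? E′) !P) (λ e∈ → proj₂ (∈-filter⁻ (_∈ᴱ? E′) {xs = P} e∈))
  kept-edge : ∀ {u v} → (u , v) ∈ kept → u Fin.< v × Adj (remove (K n) V′ E′) u v × EdgeOn W (u , v)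
  kept-edge uv∈ =
    let uv∈P , uv∉E′ = ∈-filter⁻ (∁? (_∈ᴱ? E′)) {xs = P} uv∈
        u<v , u∈W , v∈W = ∈-pairs⁻ (members-sorted (∁ V′)) uv∈P
        u≢v = Fin.<⇒≢ u<v
    in u<v
     , (u≢v , x∈∁p⇒x∉p (∈-members⁻ u∈W) , x∈∁p⇒x∉p (∈-members⁻ v∈W)
       , λ { (inj₁ uv∈E′) → uv∉E′ uv∈E′
           ; (inj₂ vu∈E′) → Fin.<-asym u<v (proj₁ (All.lookup E′-edges vu∈E′)) })
     , u≢v , u∈W , v∈W
  kept-length : length kept ≤ k * ⌊ n ∸ j /2⌋
  kept-length = begin
    length kept                             ≤⟨ colourClasses-length-≤ (colourOf adj? c) W (upTo k) kept
                                                 (edgeSet⇒sameColourDisjoint adj? c kept-edgeSet) kept-on-W kept-colours ⟩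
    length (upTo k) * ⌊ length W /2⌋        ≡⟨ cong₂ (λ a b → a * ⌊ b /2⌋) (length-upTo k) |W|≡n∸j ⟩
    k * ⌊ n ∸ j /2⌋                         ∎
    where
    adj? : ∀ u v → Dec (Adj (remove (K n) V′ E′) u v)
    adj? = remove-adj? {G = K n} K-adj? V′ E′
    kept-edgeSet : EdgeSet (remove (K n) V′ E′) kept
    kept-edgeSet = Unique.filter⁺ (∁? (_∈ᴱ? E′)) !P
                 , All.tabulate (λ { {u , v} uv∈ → let u<v , a , _ = kept-edge uv∈ in u<v , a })
    kept-on-W : All (EdgeOn W) kept
    kept-on-W = All.tabulate (λ { {u , v} uv∈ → proj₂ (proj₂ (kept-edge uv∈)) })
    kept-colours : All (λ e → colourOf adj? c e ∈ upTo k) kept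
    kept-colours = All.tabulate (λ { {u , v} uv∈ → ∈-upTo⁺ (colourOf<k adj? c (proj₁ (proj₂ (kept-edge uv∈)))) })

infix 4 _≡_mod_

_≡_mod_ : ℕ → ℕ → ℕ → Set
a ≡ b mod q = Σ ℕ λ x → Σ ℕ λ y → a + x * q ≡ b + y * q

module _ {q : ℕ} where

  ≡⇒≡[mod] : ∀ {a b} → a ≡ b → a ≡ b mod q
  ≡⇒≡[mod] refl = 0 , 0 , refl

  ≡[mod]-sym : ∀ {a b} → a ≡ b mod q → b ≡ a mod q
  ≡[mod]-sym (x , y , eq) = y , x , ≡.sym eq

  ≡[mod]-trans : ∀ {a b c} → a ≡ b mod q → b ≡ c mod q → a ≡ c mod q
  ≡[mod]-trans {a} {b} {c} (x , y , a≡b) (z , w , b≡c) = x + z , w + y , (begin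
    a + (x + z) * q        ≡⟨ split a x z q ⟩
    (a + x * q) + z * q    ≡⟨ cong (_+ z * q) a≡b ⟩
    (b + y * q) + z * q    ≡⟨ swap b y z q ⟩
    (b + z * q) + y * q    ≡⟨ cong (_+ y * q) b≡c ⟩
    (c + w * q) + y * q    ≡⟨ split c w y q ⟨
    c + (w + y) * q        ∎)
    where
    open ≡-Reasoning
    split : ∀ a x z q → a + (x + z) * q ≡ (a + x * q) + z * q
    split = solve-∀
    swap : ∀ b y z q → (b + y * q) + z * q ≡ (b + z * q) + y * q
    swap = solve-∀

  %-≡[mod] : .{{_ : NonZero q}} → ∀ a → a % q ≡ a mod q
  %-≡[mod] a = a / q , 0 , trans (≡.sym (m≡m%n+[m/n]*n a q)) (≡.sym (+-identityʳ a))

  ≡[mod]⇒≡ : .{{_ : NonZero q}} → ∀ {a b} → a < q → b < q → a ≡ b mod q → a ≡ b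
  ≡[mod]⇒≡ {a} {b} a<q b<q (x , y , eq) = begin
    a                ≡⟨ m<n⇒m%n≡m a<q ⟨
    a % q            ≡⟨ [m+kn]%n≡m%n a x q ⟨
    (a + x * q) % q  ≡⟨ cong (_% q) eq ⟩
    (b + y * q) % q  ≡⟨ [m+kn]%n≡m%n b y q ⟩
    b % q            ≡⟨ m<n⇒m%n≡m b<q ⟩
    b                ∎
    where open ≡-Reasoning

  +-cancelˡ-≡[mod] : ∀ c {a b} → c + a ≡ c + b mod q → a ≡ b mod q
  +-cancelˡ-≡[mod] c {a} {b} (x , y , eq) =
    x , y , +-cancelˡ-≡ c _ _ (trans (≡.sym (+-assoc c a (x * q))) (trans eq (+-assoc c b (y * q))))

  +-double-≡[mod] : ∀ {a b} → a ≡ b mod q → a + a ≡ b + b mod q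
  +-double-≡[mod] {a} {b} (x , y , eq) =
    x + x , y + y , trans (double a x q) (trans (cong₂ _+_ eq eq) (≡.sym (double b y q)))
    where
    double : ∀ a x q → a + a + (x + x) * q ≡ (a + x * q) + (a + x * q)
    double = solve-∀

  module _ {h : ℕ} (h+h≡1+q : h + h ≡ suc q) where

    *h+*h-≡[mod] : ∀ a → a * h + a * h ≡ a mod q
    *h+*h-≡[mod] a = 0 , a , (begin
      a * h + a * h + 0        ≡⟨ +-identityʳ _ ⟩
      a * h + a * h            ≡⟨ *-distribˡ-+ a h h ⟨
      a * (h + h)              ≡⟨ cong (a *_) h+h≡1+q ⟩
      a * suc q                ≡⟨ *-suc a q ⟩
      a + a * q                ∎)
      where open ≡-Reasoning

    *h-cancelʳ-≡[mod] : ∀ {a b} → a * h ≡ b * h mod q → a ≡ b mod q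
    *h-cancelʳ-≡[mod] {a} {b} ah≡bh = ≡[mod]-trans (≡[mod]-sym (*h+*h-≡[mod] a))
      (≡[mod]-trans (+-double-≡[mod] ah≡bh) (*h+*h-≡[mod] b))

module RoundRobin (s : ℕ) where

  q : ℕ
  q = suc (s + s)

  h : ℕ
  h = suc s

  h+h≡1+q : h + h ≡ suc q
  h+h≡1+q = cong suc (+-suc s s)

  -- The classical 1-factorisation of K_{q+1} for odd q: since h + h = q + 1, h halves modulo q,
  -- so {a,b} ⊆ [0,q) gets colour (a+b)/2, and vertex q meets each a in colour a, the one vertex
  -- left unmatched by class a.
  roundRobin : ℕ → ℕ → ℕ
  roundRobin a b with a ≟ q | b ≟ q
  ... | yes _ | _     = b
  ... | no _  | yes _ = a
  ... | no _  | no _  = (a + b) * h % q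

  roundRobin-sym : ∀ a b → roundRobin a b ≡ roundRobin b a
  roundRobin-sym a b with a ≟ q | b ≟ q
  ... | yes refl | yes refl = refl
  ... | yes _    | no _     = refl
  ... | no _     | yes _    = refl
  ... | no _     | no _     = cong (λ x → x * h % q) (+-comm a b)

  roundRobin-< : ∀ {a b} → a ≤ q → b ≤ q → a ≢ b → roundRobin a b < q
  roundRobin-< {a} {b} a≤q b≤q a≢b with a ≟ q | b ≟ q
  ... | yes refl | _       = ≤∧≢⇒< b≤q (λ b≡q → a≢b (≡.sym b≡q))
  ... | no a≢q   | yes _   = ≤∧≢⇒< a≤q a≢q
  ... | no _     | no _    = m%n<n ((a + b) * h) q

  halves-self : ∀ a → (a + a) * h ≡ a mod q
  halves-self a = ≡[mod]-trans (≡⇒≡[mod] (*-distribʳ-+ h a a)) (*h+*h-≡[mod] h+h≡1+q a)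

  halves-%-injective : ∀ a {b c} → b < q → c < q → (a + b) * h % q ≡ (a + c) * h mod q → b ≡ c
  halves-%-injective a b<q c<q eq = ≡[mod]⇒≡ b<q c<q
    (+-cancelˡ-≡[mod] a (*h-cancelʳ-≡[mod] h+h≡1+q (≡[mod]-trans (≡[mod]-sym (%-≡[mod] _)) eq)))

  roundRobin-injective : ∀ {a b c} → a ≤ q → b ≤ q → c ≤ q → a ≢ b → a ≢ c →
                         roundRobin a b ≡ roundRobin a c → b ≡ c
  roundRobin-injective {a} {b} {c} a≤q b≤q c≤q a≢b a≢c eq with a ≟ q | b ≟ q | c ≟ q
  ... | yes _   | _        | _        = eq
  ... | no _    | yes refl | yes refl = refl
  ... | no _    | no b≢q   | no c≢q   =
    halves-%-injective a (≤∧≢⇒< b≤q b≢q) (≤∧≢⇒< c≤q c≢q) (≡[mod]-trans (≡⇒≡[mod] eq) (%-≡[mod] _))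
  ... | no a≢q  | no b≢q   | yes _    = ⊥-elim (a≢b (≡.sym
    (halves-%-injective a (≤∧≢⇒< b≤q b≢q) (≤∧≢⇒< a≤q a≢q) (≡[mod]-trans (≡⇒≡[mod] eq) (≡[mod]-sym (halves-self a))))))
  ... | no a≢q  | yes _    | no c≢q   = ⊥-elim (a≢c (≡.sym
    (halves-%-injective a (≤∧≢⇒< c≤q c≢q) (≤∧≢⇒< a≤q a≢q) (≡[mod]-trans (≡⇒≡[mod] (≡.sym eq)) (≡[mod]-sym (halves-self a))))))

  module _ {n} (G : SimpleGraph n) (label≤q : ∀ {u v} → Adj G u v → toℕ u ≤ q) where

    labels-≢ : ∀ {u v} → Adj G u v → toℕ u ≢ toℕ v
    labels-≢ {u} uv eq = irrfl G (subst (Adj G u) (≡.sym (Fin.toℕ-injective eq)) uv)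

    roundRobin-<q : ∀ {u v} → Adj G u v → roundRobin (toℕ u) (toℕ v) < q
    roundRobin-<q uv = roundRobin-< (label≤q uv) (label≤q (sym G uv)) (labels-≢ uv)

    module _ {k} (roundRobin-<k : ∀ {u v} → Adj G u v → roundRobin (toℕ u) (toℕ v) < k) where

      roundRobinColouring : EdgeColouring G k
      roundRobinColouring = record
        { colour = λ _ _ uv → Fin.fromℕ< (roundRobin-<k uv)
        ; symm   = λ u v uv → Fin.toℕ-injective (begin
            toℕ (Fin.fromℕ< (roundRobin-<k uv))          ≡⟨ Fin.toℕ-fromℕ< _ ⟩
            roundRobin (toℕ u) (toℕ v)                   ≡⟨ roundRobin-sym (toℕ u) (toℕ v) ⟩
            roundRobin (toℕ v) (toℕ u)                   ≡⟨ Fin.toℕ-fromℕ< _ ⟨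
            toℕ (Fin.fromℕ< (roundRobin-<k (sym G uv)))  ∎)
        ; proper = λ u v w uv uw v≢w eq → v≢w (Fin.toℕ-injective
            (roundRobin-injective (label≤q uv) (label≤q (sym G uv)) (label≤q (sym G uw))
              (labels-≢ uv) (labels-≢ uw)
              (trans (≡.sym (Fin.toℕ-fromℕ< _)) (trans (cong toℕ eq) (Fin.toℕ-fromℕ< _)))))
        }
        where open ≡-Reasoning

      colourOf-roundRobin : (adj? : ∀ u v → Dec (Adj G u v)) → ∀ {u v} → Adj G u v →
                            colourOf adj? roundRobinColouring (u , v) ≡ roundRobin (toℕ u) (toℕ v)
      colourOf-roundRobin adj? uv =
        trans (proj₂ (colourOf-edge adj? roundRobinColouring uv)) (Fin.toℕ-fromℕ< _)

-- m − 1 for even m > 0 and m for odd m: an odd q with m ≤ q + 1 and C(m,2) = q ⌊m/2⌋.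
roundRobinColours : ℕ → ℕ
roundRobinColours m = RoundRobin.q ⌊ pred m /2⌋

≤1+roundRobinColours : ∀ m → m ≤ suc (roundRobinColours m)
≤1+roundRobinColours 0                   = z≤n
≤1+roundRobinColours 1                   = s≤s z≤n
≤1+roundRobinColours 2                   = s≤s (s≤s z≤n)
≤1+roundRobinColours (suc (suc (suc m))) =
  s≤s (s≤s (subst (suc m ≤_) (cong suc (≡.sym (+-suc ⌊ m /2⌋ ⌊ m /2⌋))) (≤1+roundRobinColours (suc m))))

roundRobinColours-≤ : ∀ m → roundRobinColours (suc m) ≤ suc m
roundRobinColours-≤ m = s≤s (begin
  ⌊ m /2⌋ + ⌊ m /2⌋   ≤⟨ +-monoʳ-≤ ⌊ m /2⌋ (⌊n/2⌋≤⌈n/2⌉ m) ⟩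
  ⌊ m /2⌋ + ⌈ m /2⌉   ≡⟨ ⌊n/2⌋+⌈n/2⌉≡n m ⟩
  m                   ∎)
  where open ≤-Reasoning

C2≡roundRobinColours*⌊/2⌋ : ∀ m → m C 2 ≡ roundRobinColours m * ⌊ m /2⌋
C2≡roundRobinColours*⌊/2⌋ 0 = refl
C2≡roundRobinColours*⌊/2⌋ 1 = refl
C2≡roundRobinColours*⌊/2⌋ 2 = refl
C2≡roundRobinColours*⌊/2⌋ (suc (suc (suc m))) = begin
  suc (suc (suc m)) C 2                         ≡⟨ suc-C2 (suc (suc m)) ⟩
  suc (suc m) + suc (suc m) C 2                 ≡⟨ cong (suc (suc m) +_) (suc-C2 (suc m)) ⟩
  suc (suc m) + (suc m + suc m C 2)             ≡⟨ cong (λ x → suc (suc m) + (suc m + x)) (C2≡roundRobinColours*⌊/2⌋ (suc m)) ⟩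
  suc (suc m) + (suc m + suc (s + s) * t)       ≡⟨ cong (λ x → suc (suc x) + (suc x + suc (s + s) * t)) (⌊n/2⌋+⌈n/2⌉≡n m) ⟨
  suc (suc (s + t)) + (suc (s + t) + suc (s + s) * t)
                                                ≡⟨ step s t ⟩
  suc (suc s + suc s) * suc t                   ∎
  where
  open ≡-Reasoning
  s t : ℕ
  s = ⌊ m /2⌋
  t = ⌈ m /2⌉
  step : ∀ s t → suc (suc (s + t)) + (suc (s + t) + suc (s + s) * t) ≡ suc (suc s + suc s) * suc t
  step = solve-∀

module UpperBound (n k j : ℕ) (j≤n : j ≤ n) where

  m : ℕ
  m = n ∸ j
  open RoundRobin ⌊ pred m /2⌋

  V₀ : Subset n
  V₀ = atLeast m

  ∣V₀∣≡j : ∣ V₀ ∣ ≡ j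
  ∣V₀∣≡j = trans (∣atLeast∣ n m) (m∸[m∸n]≡n j≤n)

  W₀ : List (Fin n)
  W₀ = members (∁ V₀)

  Kₘ : SimpleGraph n
  Kₘ = remove (K n) V₀ []

  Kₘ-adj? : ∀ u v → Dec (Adj Kₘ u v)
  Kₘ-adj? = remove-adj? {G = K n} K-adj? V₀ []

  label≤q : ∀ {E u v} → Adj (remove (K n) V₀ E) u v → toℕ u ≤ q
  label≤q (_ , u∉ , _) = s≤s⁻¹ (≤-trans (∉atLeast⇒< u∉) (≤1+roundRobinColours m))

  W₀-sorted : AllPairs Fin._<_ W₀
  W₀-sorted = members-sorted (∁ V₀)

  colouringₘ : EdgeColouring Kₘ q
  colouringₘ = roundRobinColouring Kₘ label≤q (roundRobin-<q Kₘ label≤q)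

  pairColour : Fin n × Fin n → ℕ
  pairColour (u , v) = roundRobin (toℕ u) (toℕ v)

  P₀ : List (Fin n × Fin n)
  P₀ = pairs W₀

  heavy? : ∀ e → Dec (k ≤ pairColour e)
  heavy? e = k ≤? pairColour e

  E₀ : List (Fin n × Fin n)
  E₀ = filter heavy? P₀

  W₀∋ : ∀ {u} → u ∉ᵖ V₀ → u ∈ W₀
  W₀∋ u∉ = ∈-members⁺ (x∉p⇒x∈∁p u∉)

  P₀-edge : ∀ {u v} → (u , v) ∈ P₀ → u Fin.< v × Adj Kₘ u v × EdgeOn W₀ (u , v)
  P₀-edge uv∈ =
    let u<v , u∈W , v∈W = ∈-pairs⁻ W₀-sorted uv∈
        u≢v = Fin.<⇒≢ u<v
    in u<v , (u≢v , x∈∁p⇒x∉p (∈-members⁻ u∈W) , x∈∁p⇒x∉p (∈-members⁻ v∈W) , λ { (inj₁ ()) ; (inj₂ ()) })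
     , u≢v , u∈W , v∈W

  !P₀ : Unique P₀
  !P₀ = unique-pairs (AllPairs.map Fin.<⇒≢ W₀-sorted)

  E₀-edge : ∀ {u v} → (u , v) ∈ E₀ → u Fin.< v × Adj Kₘ u v × EdgeOn W₀ (u , v)
  E₀-edge uv∈ = P₀-edge (proj₁ (∈-filter⁻ heavy? {xs = P₀} uv∈))

  E₀-edgeSet : EdgeSet Kₘ E₀
  E₀-edgeSet = Unique.filter⁺ heavy? !P₀
             , All.tabulate (λ { {u , v} uv∈ → let u<v , uv , _ = E₀-edge uv∈ in u<v , uv })

  G₀ : SimpleGraph n
  G₀ = remove (K n) V₀ E₀

  G₀-light : ∀ {u v} → Adj G₀ u v → pairColour (u , v) < k
  G₀-light {u} {v} (u≢v , u∉ , v∉ , uv∉E₀) with heavy? (u , v)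
  ... | no light = ≰⇒> light
  ... | yes heavy with Fin.<-cmp u v
  ...   | tri< u<v _ _ = ⊥-elim (uv∉E₀ (inj₁ (∈-filter⁺ heavy? (∈-pairs⁺ Fin.<-asym W₀-sorted (W₀∋ u∉) (W₀∋ v∉) u<v) heavy)))
  ...   | tri≈ _ u≡v _ = ⊥-elim (u≢v u≡v)
  ...   | tri> _ _ v<u = ⊥-elim (uv∉E₀ (inj₂ (∈-filter⁺ heavy? (∈-pairs⁺ Fin.<-asym W₀-sorted (W₀∋ v∉) (W₀∋ u∉) v<u)
                           (subst (k ≤_) (roundRobin-sym (toℕ u) (toℕ v)) heavy))))

  mixedRemovalSet : MixedRemovalSet (K n) k j E₀
  mixedRemovalSet = (proj₁ E₀-edgeSet , All.map (λ (u<v , u≢v , _) → u<v , u≢v) (proj₂ E₀-edgeSet))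
                  , V₀ , ∣V₀∣≡j
                  , roundRobinColouring G₀ label≤q G₀-light

  colourₘ : Fin n × Fin n → ℕ
  colourₘ = colourOf Kₘ-adj? colouringₘ

  E₀-colours : All (λ e → colourₘ e ∈ applyUpTo (k +_) (q ∸ k)) E₀
  E₀-colours = All.tabulate λ { {u , v} uv∈ →
    let _ , uv , _ = E₀-edge uv∈
        colour≡ = colourOf-roundRobin Kₘ label≤q (roundRobin-<q Kₘ label≤q) Kₘ-adj? uv
        k≤c = subst (k ≤_) (≡.sym colour≡) (proj₂ (∈-filter⁻ heavy? {xs = P₀} uv∈))
        c<q = subst (_< q) (≡.sym colour≡) (roundRobin-<q Kₘ label≤q uv)
    in subst (_∈ applyUpTo (k +_) (q ∸ k)) (m+[n∸m]≡n k≤c) (∈-applyUpTo⁺ (k +_) (∸-monoˡ-< c<q k≤c)) }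

  E₀-length : length E₀ ≤ m C 2 ∸ ⌊ m /2⌋ * k
  E₀-length = begin
    length E₀                                  ≤⟨ colourClasses-length-≤ colourₘ W₀ (applyUpTo (k +_) (q ∸ k)) E₀
                                                    (edgeSet⇒sameColourDisjoint Kₘ-adj? colouringₘ E₀-edgeSet)
                                                    (All.tabulate (λ { {u , v} uv∈ → proj₂ (proj₂ (E₀-edge uv∈)) }))
                                                    E₀-colours ⟩
    length (applyUpTo (k +_) (q ∸ k)) * ⌊ length W₀ /2⌋
                                               ≡⟨ cong₂ (λ a b → a * ⌊ b /2⌋) (length-applyUpTo (k +_) (q ∸ k))
                                                    (length-members-∁ V₀ ∣V₀∣≡j) ⟩
    (q ∸ k) * ⌊ m /2⌋                          ≡⟨ *-distribʳ-∸ ⌊ m /2⌋ q k ⟩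
    q * ⌊ m /2⌋ ∸ k * ⌊ m /2⌋                  ≡⟨ cong₂ _∸_ (C2≡roundRobinColours*⌊/2⌋ m) (*-comm ⌊ m /2⌋ k) ⟨
    m C 2 ∸ ⌊ m /2⌋ * k                        ∎
    where open ≤-Reasoning

K-isLambda : ∀ n k j → j ≤ n → IsLambda (K n) k j ((n ∸ j) C 2 ∸ ⌊ n ∸ j /2⌋ * k)
K-isLambda n k j j≤n = (E₀ , mixedRemovalSet , ≤-antisym E₀-length (minimal E₀ mixedRemovalSet)) , minimal
  where
  open UpperBound n k j j≤n
  minimal : ∀ E′ → MixedRemovalSet (K n) k j E′ → m C 2 ∸ ⌊ m /2⌋ * k ≤ length E′
  minimal E′ E′-removes = m≤n+o⇒m∸n≤o (m C 2) (⌊ m /2⌋ * k) (mixedRemovalSet-lowerBound E′-removes)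

C2∸⌊/2⌋*k≡0 : ∀ {m k} → m ≤ k → m C 2 ∸ ⌊ m /2⌋ * k ≡ 0
C2∸⌊/2⌋*k≡0 {zero}  _   = refl
C2∸⌊/2⌋*k≡0 {suc m} {k} 1+m≤k = m≤n⇒m∸n≡0 (begin
  suc m C 2                                    ≡⟨ C2≡roundRobinColours*⌊/2⌋ (suc m) ⟩
  roundRobinColours (suc m) * ⌊ suc m /2⌋      ≤⟨ *-monoˡ-≤ ⌊ suc m /2⌋ (≤-trans (roundRobinColours-≤ m) 1+m≤k) ⟩
  k * ⌊ suc m /2⌋                              ≡⟨ *-comm k _ ⟩
  ⌊ suc m /2⌋ * k                              ∎)
  where open ≤-Reasoning

⌊n/2⌋≡n/2 : ∀ n → ⌊ n /2⌋ ≡ n / 2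
⌊n/2⌋≡n/2 0             = refl
⌊n/2⌋≡n/2 1             = refl
⌊n/2⌋≡n/2 (suc (suc n)) = trans (cong suc (⌊n/2⌋≡n/2 n)) (≡.sym (m/n≡1+[m∸n]/n {suc (suc n)} {2} (s≤s (s≤s z≤n))))

mainTheorem18 : (n k j : ℕ) → 1 ≤ k → j ≤ n / 2 →
    (n ∸ j ≤ k → IsLambda (K n) k j 0)
    × (k < n ∸ j → IsLambda (K n) k j (((n ∸ j) C 2) ∸ ((n ∸ j) / 2) * k))
mainTheorem18 n k j _ j≤n/2 =
    (λ n∸j≤k → subst (IsLambda (K n) k j) (C2∸⌊/2⌋*k≡0 n∸j≤k) λ-formula)
  , (λ _ → subst (IsLambda (K n) k j) (cong (λ h → (n ∸ j) C 2 ∸ h * k) (⌊n/2⌋≡n/2 (n ∸ j))) λ-formula)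
  where
  λ-formula : IsLambda (K n) k j ((n ∸ j) C 2 ∸ ⌊ n ∸ j /2⌋ * k)
  λ-formula = K-isLambda n k j (≤-trans j≤n/2 (m/n≤m n 2))
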